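{- Let $R$ be a finite vertex-weighted tree of total weight $n$ and let $q\ge 0$. If $R$ has two vertex $q$-centers, then every edge on the path in $R$ between them is an edge $q$-center.
   Context: A vertex or edge of a vertex-weighted tree (nonnegative weights) of total weight $n$ is a $q$-center if its removal separates the tree into subtrees (components) each of total weight at most $\frac n2+q$.
   Formalization: The vertex weights and the parameter $q$ are nonnegative rationals. -}

module Defs where

open import Data.Nat using (ℕ; zero; suc) renaming (_≤_ to _≤ℕ_)
open import Data.Fin using (Fin)
import Data.Fin
import Data.Fin.Subset.Properties
open import Data.Fin.Subset using (Subset; _∈_; _∉_)
open import Data.List using (List; []; _∷_; length)
open import Data.List.Relation.Unary.Unique.Propositional using (Unique)
open import Data.Rational using (ℚ; 0ℚ; ½; _+_; _*_; _≤_)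
open import Data.Product using (_×_; Σ; ∃; ∃-syntax; _,_)
open import Data.Sum using (_⊎_)
open import Relation.Nullary using (¬_; Dec; yes; no)
open import Relation.Binary.PropositionalEquality using (_≡_; _≢_)

data Walk {k : ℕ} (E : Fin k → Fin k → Set) : Fin k → Fin k → Set where
  []  : ∀ {x} → Walk E x x
  _∷_ : ∀ {x y z} → E x y → Walk E y z → Walk E x z

vertices : ∀ {k} {E : Fin k → Fin k → Set} {x y} → Walk E x y → List (Fin k)
vertices {x = x} []       = x ∷ []
vertices {x = x} (_ ∷ w)  = x ∷ vertices w

len : ∀ {k} {E : Fin k → Fin k → Set} {x y} → Walk E x y → ℕ
len []      = zero
len (_ ∷ w) = suc (len w)

IsPath : ∀ {k} {E : Fin k → Fin k → Set} {x y} → Walk E x y → Set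
IsPath w = Unique (vertices w)

data EdgeOf {k : ℕ} {E : Fin k → Fin k → Set} (a b : Fin k) : ∀ {x y} → Walk E x y → Set where
  here  : ∀ {z} (e : E a b) (w : Walk E b z) → EdgeOf a b (e ∷ w)
  there : ∀ {x y z} (e : E x y) {w : Walk E y z} → EdgeOf a b w → EdgeOf a b (e ∷ w)

-- a finite simple graph on vertex set Fin k which is a tree:
-- symmetric, irreflexive adjacency; connected; acyclic (no cycle of length ≥ 3)
record IsTree {k : ℕ} (E : Fin k → Fin k → Set) : Set where
  field
    sym       : ∀ {x y} → E x y → E y x
    irrefl    : ∀ {x} → ¬ E x x
    nonempty  : Fin k
    connected : ∀ x y → Walk E x y
    acyclic   : ∀ x y (p : Walk E x y) → IsPath p → 2 ≤ℕ len p → ¬ E y x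

-- graph with vertex v deleted (v becomes isolated; it is excluded separately)
DelVertex : ∀ {k} → (Fin k → Fin k → Set) → Fin k → Fin k → Fin k → Set
DelVertex E v x y = E x y × x ≢ v × y ≢ v

DelEdge : ∀ {k} → (Fin k → Fin k → Set) → Fin k → Fin k → Fin k → Fin k → Set
DelEdge E a b x y = E x y × ¬ (x ≡ a × y ≡ b) × ¬ (x ≡ b × y ≡ a)

record IsComponent {k : ℕ} (E : Fin k → Fin k → Set) (S : Subset k) : Set where
  field
    inhabited : ∃[ x ] x ∈ S
    closed    : ∀ {x y} → x ∈ S → E x y → y ∈ S
    conn      : ∀ {x y} → x ∈ S → y ∈ S → Walk E x y

sumFin : ∀ {k} → (Fin k → ℚ) → ℚ
sumFin {zero}  f = 0ℚ
sumFin {suc k} f = f Fin.zero + sumFin (λ i → f (Fin.suc i))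

weightOf : ∀ {k} → (Fin k → ℚ) → Subset k → ℚ
weightOf {k} w S = sumFin (λ i → ind i)
  where
  ind : Fin k → ℚ
  ind i with Data.Fin.Subset.Properties._∈?_ i S
  ... | yes _ = w i
  ... | no  _ = 0ℚ

totalWeight : ∀ {k} → (Fin k → ℚ) → ℚ
totalWeight {k} w = sumFin w

IsVertexQCenter : ∀ {k} → (Fin k → Fin k → Set) → (Fin k → ℚ) → ℚ → Fin k → Set
IsVertexQCenter {k} E w q v =
  ∀ (S : Subset k) → v ∉ S → IsComponent (DelVertex E v) S →
    weightOf w S ≤ ½ * totalWeight w + q

IsEdgeQCenter : ∀ {k} → (Fin k → Fin k → Set) → (Fin k → ℚ) → ℚ → Fin k → Fin k → Set
IsEdgeQCenter {k} E w q a b =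
  ∀ (S : Subset k) → IsComponent (DelEdge E a b) S →
    weightOf w S ≤ ½ * totalWeight w + q

-- Let ab be an edge of the u–v path, a on the side of u. Deleting it splits the tree into
-- the side of a, containing u, and the side of b, containing v; a component S of R − ab lies
-- on one of them and so misses u or v. A connected vertex set missing a vertex z lies in a
-- single component of R − z, so when z is a vertex q-center and the weights are nonnegative,
-- the weight of S is at most n/2 + q.
module Submission where

open import Defs
open import Data.Nat using (ℕ; zero; suc; s≤s; z≤n) renaming (_≤_ to _≤ℕ_)
open import Data.Fin using (Fin; _≟_)
import Data.Fin as Fin
open import Data.Fin.Subset using (Subset; _∈_; _∉_; _⊆_)
import Data.Fin.Subset.Properties as Subsetₚ
open import Data.Vec using (tabulate)
open import Data.Vec.Properties using (lookup∘tabulate; lookup⇒[]=; []=⇒lookup)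
open import Data.Bool.Properties using (T-≡)
open import Data.List using (List; []; _∷_)
open import Data.List.Relation.Unary.Any using (here; there; any?)
open import Data.List.Relation.Unary.All using ([])
import Data.List.Relation.Unary.All as All
open import Data.List.Relation.Unary.All.Properties using (¬Any⇒All¬; All¬⇒¬Any)
open import Data.List.Relation.Unary.AllPairs using ([]; _∷_)
open import Data.List.Relation.Unary.Unique.Propositional using (Unique)
open import Data.List.Membership.Propositional using () renaming (_∈_ to _∈ₗ_; _∉_ to _∉ₗ_)
open import Data.List.Relation.Binary.Subset.Propositional using () renaming (_⊆_ to _⊆ₗ_)
open import Data.Rational using (ℚ; 0ℚ; _≤_; ½; _*_; _+_)
import Data.Rational.Properties as ℚₚ
open import Data.Product using (_×_; Σ-syntax; ∃-syntax; _,_; proj₁; proj₂)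
open import Data.Sum using (_⊎_; inj₁; inj₂; [_,_])
open import Data.Empty using (⊥-elim)
open import Function using (_∘_; Equivalence)
open import Relation.Unary using (Pred; Decidable)
open import Relation.Binary.Definitions using (Symmetric)
open import Relation.Nullary using (¬_; Dec; yes; no; ¬?)
open import Relation.Nullary.Decidable using (isYes; fromWitness; toWitness)
open import Relation.Binary.PropositionalEquality using (_≡_; _≢_; refl; sym; trans; cong; subst)

private
  variable
    k : ℕ
    a b u v x y z t : Fin k

Graph : ℕ → Set₁
Graph k = Fin k → Fin k → Set

private
  variable
    G H : Graph k

start∈vertices : (w : Walk G x y) → x ∈ₗ vertices w
start∈vertices []      = here refl
start∈vertices (_ ∷ _) = here refl

end∈vertices : (w : Walk G x y) → y ∈ₗ vertices w
end∈vertices []      = here refl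
end∈vertices (_ ∷ w) = there (end∈vertices w)

map : (∀ {x y} → G x y → H x y) → Walk G x y → Walk H x y
map f []      = []
map f (e ∷ w) = f e ∷ map f w

vertices-map : (f : ∀ {x y} → G x y → H x y) (w : Walk G x y) → vertices (map f w) ≡ vertices w
vertices-map f []      = refl
vertices-map f (e ∷ w) = cong (_ ∷_) (vertices-map f w)

isPath-map : (f : ∀ {x y} → G x y → H x y) (w : Walk G x y) → IsPath w → IsPath (map f w)
isPath-map f w = subst Unique (sym (vertices-map f w))

mapWithin : (P : Fin k → Set) → (∀ {x y} → G x y → P x → P y → H x y) →
            (w : Walk G x y) → (∀ {t} → t ∈ₗ vertices w → P t) → Walk H x y
mapWithin P f []      _   = []
mapWithin P f (e ∷ w) P-w = f e (P-w (here refl)) (P-w (there (start∈vertices w))) ∷ mapWithin P f w (P-w ∘ there)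

_++ʷ_ : Walk G x y → Walk G y z → Walk G x z
[]       ++ʷ w₂ = w₂
(e ∷ w₁) ++ʷ w₂ = e ∷ (w₁ ++ʷ w₂)

∈-++ʷ⁻ : (w₁ : Walk G x y) (w₂ : Walk G y z) →
         t ∈ₗ vertices (w₁ ++ʷ w₂) → t ∈ₗ vertices w₁ ⊎ t ∈ₗ vertices w₂
∈-++ʷ⁻ []       w₂ t∈      = inj₂ t∈
∈-++ʷ⁻ (e ∷ w₁) w₂ (here p) = inj₁ (here p)
∈-++ʷ⁻ (e ∷ w₁) w₂ (there t∈) with ∈-++ʷ⁻ w₁ w₂ t∈
... | inj₁ t∈w₁ = inj₁ (there t∈w₁)
... | inj₂ t∈w₂ = inj₂ t∈w₂

∉-++ʷ⁺ : (w₁ : Walk G x y) (w₂ : Walk G y z) →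
         t ∉ₗ vertices w₁ → t ∉ₗ vertices w₂ → t ∉ₗ vertices (w₁ ++ʷ w₂)
∉-++ʷ⁺ w₁ w₂ t∉w₁ t∉w₂ = [ t∉w₁ , t∉w₂ ] ∘ ∈-++ʷ⁻ w₁ w₂

reverse : Symmetric G → Walk G x y → Walk G y x
reverse sym []      = []
reverse sym (e ∷ w) = reverse sym w ++ʷ (sym e ∷ [])

∈-reverse⁻ : (sym : Symmetric G) (w : Walk G x y) → t ∈ₗ vertices (reverse sym w) → t ∈ₗ vertices w
∈-reverse⁻ sym []      t∈ = t∈
∈-reverse⁻ sym (e ∷ w) t∈ with ∈-++ʷ⁻ (reverse sym w) (sym e ∷ []) t∈
... | inj₁ t∈w              = there (∈-reverse⁻ sym w t∈w)
... | inj₂ (here refl)      = there (start∈vertices w)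
... | inj₂ (there (here refl)) = here refl

distinct⇒len≥1 : (w : Walk G x y) → x ≢ y → 1 ≤ℕ len w
distinct⇒len≥1 []      x≢x = ⊥-elim (x≢x refl)
distinct⇒len≥1 (_ ∷ _) _   = s≤s z≤n

_∈ₗ?_ : (x : Fin k) (xs : List (Fin k)) → Dec (x ∈ₗ xs)
x ∈ₗ? xs = any? (x ≟_) xs

suffixFrom : (w : Walk G y z) → x ∈ₗ vertices w →
             Σ[ w′ ∈ Walk G x z ] vertices w′ ⊆ₗ vertices w × (IsPath w → IsPath w′)
suffixFrom []      (here refl) = [] , (λ t∈ → t∈) , (λ p → p)
suffixFrom (e ∷ w) (here refl) = (e ∷ w) , (λ t∈ → t∈) , (λ p → p)
suffixFrom (e ∷ w) (there x∈) with suffixFrom w x∈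
... | w′ , w′⊆w , path⇒path = w′ , there ∘ w′⊆w , λ { (_ ∷ p) → path⇒path p }

toPath : (w : Walk G x y) → Σ[ p ∈ Walk G x y ] IsPath p × vertices p ⊆ₗ vertices w
toPath []                 = [] , [] ∷ [] , (λ t∈ → t∈)
toPath {x = x} (e ∷ w) with toPath w
... | p , p-path , p⊆w with x ∈ₗ? vertices p
...   | yes x∈p = let p′ , p′⊆p , path⇒path = suffixFrom p x∈p
                  in p′ , path⇒path p-path , there ∘ p⊆w ∘ p′⊆p
...   | no x∉p  = (e ∷ p) , ¬Any⇒All¬ (vertices p) x∉p ∷ p-path ,
                  λ { (here t≡x) → here t≡x ; (there t∈) → there (p⊆w t∈) }

module _ {ℓ} {P : Pred (Fin k) ℓ} (P? : Decidable P) where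

  fromDec : Subset k
  fromDec = tabulate (λ x → isYes (P? x))

  ∈-fromDec⁺ : P x → x ∈ fromDec
  ∈-fromDec⁺ {x} px = lookup⇒[]= x fromDec (trans (lookup∘tabulate _ x) (Equivalence.to T-≡ (fromWitness px)))

  ∈-fromDec⁻ : x ∈ fromDec → P x
  ∈-fromDec⁻ {x} x∈ =
    toWitness {a? = P? x} (Equivalence.from T-≡ (trans (sym (lookup∘tabulate _ x)) ([]=⇒lookup x∈)))

component-contains-walk : ∀ {S} → IsComponent G S → (w : Walk G x y) → x ∈ S →
                          t ∈ₗ vertices w → t ∈ S
component-contains-walk C []      x∈S (here refl) = x∈S
component-contains-walk C (e ∷ w) x∈S (here refl) = x∈S
component-contains-walk C (e ∷ w) x∈S (there t∈)  =
  component-contains-walk C w (IsComponent.closed C x∈S e) t∈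

DelVertex-walk-avoids : ∀ {E : Graph k} → x ≢ z → (w : Walk (DelVertex E z) x y) → z ∉ₗ vertices w
DelVertex-walk-avoids x≢z []                   (here z≡x)  = x≢z (sym z≡x)
DelVertex-walk-avoids x≢z (_ ∷ _)              (here z≡x)  = x≢z (sym z≡x)
DelVertex-walk-avoids x≢z ((_ , _ , y≢z) ∷ w) (there z∈w) = DelVertex-walk-avoids y≢z w z∈w

DelVertex-sym : ∀ {E : Graph k} → Symmetric E → Symmetric (DelVertex E z)
DelVertex-sym E-sym (e , x≢z , y≢z) = E-sym e , y≢z , x≢z

DelEdge-sym : ∀ {E : Graph k} → Symmetric E → Symmetric (DelEdge E a b)
DelEdge-sym E-sym (e , ≢ab , ≢ba) = E-sym e , (λ (y≡a , x≡b) → ≢ba (x≡b , y≡a)) , (λ (y≡b , x≡a) → ≢ab (x≡a , y≡b))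

component-reaches : ∀ {S} → IsComponent G S → Walk G x y → x ∈ S → y ∈ S
component-reaches C w x∈S = component-contains-walk C w x∈S (end∈vertices w)

module _ {E : Graph k} (tree : IsTree E) where
  open IsTree tree renaming (sym to E-sym)

  path-unique : (p q : Walk E x y) → IsPath p → IsPath q → vertices p ≡ vertices q
  path-unique []      []      _           _           = refl
  path-unique []      (_ ∷ q) _           (x∉q ∷ _)   = ⊥-elim (All.lookup x∉q (end∈vertices q) refl)
  path-unique (_ ∷ p) []      (x∉p ∷ _)   _           = ⊥-elim (All.lookup x∉p (end∈vertices p) refl)
  path-unique {x = x} (_∷_ {y = p₁} e p) (_∷_ {y = q₁} f q) (x∉p ∷ p-path) (x∉q ∷ q-path)
    with p₁ ≟ q₁
  ... | yes refl = cong (x ∷_) (path-unique p q p-path q-path)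
  ... | no p₁≢q₁ =
    -- leaving x through two different neighbours, p and q close up a cycle through x
    let c , c-path , c⊆ = toPath (p ++ʷ reverse E-sym q)
        x∉c = ∉-++ʷ⁺ p (reverse E-sym q) (All¬⇒¬Any x∉p) (All¬⇒¬Any x∉q ∘ ∈-reverse⁻ E-sym q) ∘ c⊆
    in ⊥-elim (acyclic x q₁ (e ∷ c) (¬Any⇒All¬ _ x∉c ∷ c-path) (s≤s (distinct⇒len≥1 c p₁≢q₁)) (E-sym f))

  edge-is-bridge : E x y → ¬ Walk (DelEdge E x y) x y
  edge-is-bridge e w with toPath w
  ... | []           , _      , _ = irrefl e
  ... | d ∷ []       , _      , _ = proj₁ (proj₂ d) (refl , refl)
  ... | p@(_ ∷ _ ∷ _) , p-path , _ =
    acyclic _ _ (map proj₁ p) (isPath-map proj₁ p p-path) (s≤s (s≤s z≤n)) (E-sym e)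

-- The component of s in E − z, described as the vertices whose tree path from s avoids z.
module Side {E : Graph k} (tree : IsTree E) (z s : Fin k) where
  open IsTree tree renaming (sym to E-sym)

  treePath : ∀ x → Walk E s x
  treePath x = proj₁ (toPath (connected s x))

  treePath-isPath : ∀ x → IsPath (treePath x)
  treePath-isPath x = proj₁ (proj₂ (toPath (connected s x)))

  side : Subset k
  side = fromDec (λ x → ¬? (z ∈ₗ? vertices (treePath x)))

  z∉side : z ∉ side
  z∉side z∈side = ∈-fromDec⁻ _ z∈side (end∈vertices (treePath z))

  walk⇒∈side : s ≢ z → Walk (DelVertex E z) s x → x ∈ side
  walk⇒∈side {x} s≢z w = ∈-fromDec⁺ _ λ z∈treePath →
    let p , p-path , p⊆w = toPath (map proj₁ w)
        z∈p = subst (z ∈ₗ_) (path-unique tree (treePath x) p (treePath-isPath x) p-path) z∈treePath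
    in DelVertex-walk-avoids s≢z w (subst (z ∈ₗ_) (vertices-map proj₁ w) (p⊆w z∈p))

  ∈side⇒walk : x ∈ side → Walk (DelVertex E z) s x
  ∈side⇒walk {x} x∈side = mapWithin (_≢ z) (λ e x≢z y≢z → e , x≢z , y≢z) (treePath x)
    λ t∈ t≡z → ∈-fromDec⁻ _ x∈side (subst (_∈ₗ vertices (treePath x)) t≡z t∈)

  side-isComponent : s ≢ z → IsComponent (DelVertex E z) side
  side-isComponent s≢z = record
    { inhabited = s , walk⇒∈side s≢z []
    ; closed    = λ x∈side e → walk⇒∈side s≢z (∈side⇒walk x∈side ++ʷ (e ∷ []))
    ; conn      = λ x∈side y∈side → reverse (DelVertex-sym E-sym) (∈side⇒walk x∈side) ++ʷ ∈side⇒walk y∈side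
    }

component-⊆-vertexComponent : ∀ {E : Graph k} → IsTree E → (∀ {x y} → G x y → E x y) →
  ∀ {S} → IsComponent G S → z ∉ S →
  ∃[ S′ ] IsComponent (DelVertex E z) S′ × z ∉ S′ × S ⊆ S′
component-⊆-vertexComponent {G = G} {z = z} {E = E} tree G⊆E {S} C z∉S
  with IsComponent.inhabited C
... | s , s∈S =
  side , side-isComponent s≢z , z∉side , λ x∈S → walk⇒∈side s≢z (walkInside (IsComponent.conn C s∈S x∈S))
  where
  open Side tree z s

  ∈S⇒≢z : t ∈ S → t ≢ z
  ∈S⇒≢z t∈S refl = z∉S t∈S

  s≢z : s ≢ z
  s≢z = ∈S⇒≢z s∈S

  walkInside : Walk G s x → Walk (DelVertex E z) s x
  walkInside w = mapWithin (_∈ S) (λ e x∈S y∈S → G⊆E e , ∈S⇒≢z x∈S , ∈S⇒≢z y∈S) w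
    (component-contains-walk C w s∈S)

sumFin-mono : {f g : Fin k → ℚ} → (∀ i → f i ≤ g i) → sumFin f ≤ sumFin g
sumFin-mono {k = zero}  f≤g = ℚₚ.≤-refl
sumFin-mono {k = suc k} f≤g = ℚₚ.+-mono-≤ (f≤g Fin.zero) (sumFin-mono (f≤g ∘ Fin.suc))

-- The summands of weightOf are a function local to it that cannot be named here,
-- so the type of weightOf-summand-mono is left to unification.
mutual
  weightOf-mono : {w : Fin k → ℚ} → (∀ i → 0ℚ ≤ w i) → {S S′ : Subset k} → S ⊆ S′ →
                  weightOf w S ≤ weightOf w S′
  weightOf-mono w≥0 S⊆S′ = sumFin-mono (weightOf-summand-mono w≥0 S⊆S′)

  weightOf-summand-mono : {w : Fin k → ℚ} → (∀ i → 0ℚ ≤ w i) → {S S′ : Subset k} → S ⊆ S′ → ∀ i → _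
  weightOf-summand-mono w≥0 {S} {S′} S⊆S′ i with i Subsetₚ.∈? S | i Subsetₚ.∈? S′
  ... | yes _   | yes _    = ℚₚ.≤-refl
  ... | yes i∈S | no i∉S′  = ⊥-elim (i∉S′ (S⊆S′ i∈S))
  ... | no _    | yes _    = w≥0 i
  ... | no _    | no _     = ℚₚ.≤-refl

vertexQCenter-bound : ∀ {E : Graph k} {w q} → IsTree E → (∀ i → 0ℚ ≤ w i) → IsVertexQCenter E w q z →
  (∀ {x y} → G x y → E x y) → ∀ {S} → IsComponent G S → z ∉ S →
  weightOf w S ≤ ½ * totalWeight w + q
vertexQCenter-bound tree w≥0 center G⊆E C z∉S =
  let S′ , S′-component , z∉S′ , S⊆S′ = component-⊆-vertexComponent tree G⊆E C z∉S
  in ℚₚ.≤-trans (weightOf-mono w≥0 S⊆S′) (center S′ z∉S′ S′-component)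

EdgeOf⇒∈vertices : ∀ {E : Graph k} {w : Walk E x y} → EdgeOf a b w → b ∈ₗ vertices w
EdgeOf⇒∈vertices (here e w)  = there (start∈vertices w)
EdgeOf⇒∈vertices (there e r) = there (EdgeOf⇒∈vertices r)

path-splits-at-edge : ∀ {E : Graph k} (p : Walk E u v) → IsPath p → EdgeOf a b p →
  E a b × (Σ[ p₁ ∈ Walk E u a ] b ∉ₗ vertices p₁) × (Σ[ p₂ ∈ Walk E b v ] a ∉ₗ vertices p₂)
path-splits-at-edge (e ∷ w) (u∉w ∷ _) (here e w) =
  e , ([] , λ { (here b≡u) → All.lookup u∉w (start∈vertices w) (sym b≡u) }) , (w , λ a∈w → All.lookup u∉w a∈w refl)
path-splits-at-edge (e′ ∷ w) (u∉w ∷ w-path) (there e′ r) =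
  let e , (p₁ , b∉p₁) , p₂ = path-splits-at-edge w w-path r
      b∉e′∷p₁ = λ { (here b≡u) → All.lookup u∉w (EdgeOf⇒∈vertices r) (sym b≡u) ; (there b∈p₁) → b∉p₁ b∈p₁ }
  in e , ((e′ ∷ p₁) , b∉e′∷p₁) , p₂

edge-avoiding-endpoint : ∀ {E : Graph k} {c} → c ≡ a ⊎ c ≡ b → E x y → x ≢ c → y ≢ c → DelEdge E a b x y
edge-avoiding-endpoint (inj₁ refl) e x≢a y≢a = e , (λ (x≡a , _) → x≢a x≡a) , (λ (_ , y≡a) → y≢a y≡a)
edge-avoiding-endpoint (inj₂ refl) e x≢b y≢b = e , (λ (_ , y≡b) → y≢b y≡b) , (λ (x≡b , _) → x≢b x≡b)

walk-avoiding-endpoint : ∀ {E : Graph k} {c} → c ≡ a ⊎ c ≡ b →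
  (w : Walk E x y) → c ∉ₗ vertices w → Walk (DelEdge E a b) x y
walk-avoiding-endpoint {E = E} c∈ab w c∉w =
  mapWithin (_≢ _) (edge-avoiding-endpoint {E = E} c∈ab) w (λ t∈w t≡c → c∉w (subst (_∈ₗ vertices w) t≡c t∈w))

component-misses-end : ∀ {E : Graph k} → IsTree E → (p : Walk E u v) → IsPath p → EdgeOf a b p →
  ∀ {S} → IsComponent (DelEdge E a b) S → u ∉ S ⊎ v ∉ S
component-misses-end {a = a} tree p p-path ab∈p {S} C
  with path-splits-at-edge p p-path ab∈p | a Subsetₚ.∈? S
... | e , _ , (p₂ , a∉p₂) | yes a∈S = inj₂ λ v∈S →
  let v⇝b = reverse (DelEdge-sym (IsTree.sym tree)) (walk-avoiding-endpoint (inj₁ refl) p₂ a∉p₂)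
  in edge-is-bridge tree e (IsComponent.conn C a∈S (component-reaches C v⇝b v∈S))
... | _ , (p₁ , b∉p₁) , _ | no a∉S = inj₁ λ u∈S →
  a∉S (component-reaches C (walk-avoiding-endpoint (inj₂ refl) p₁ b∉p₁) u∈S)

lemma3p16 : ∀ {k : ℕ} (E : Fin k → Fin k → Set) → IsTree E →
    (w : Fin k → ℚ) → (∀ i → 0ℚ ≤ w i) →
    (q : ℚ) → 0ℚ ≤ q →
    (u v : Fin k) → IsVertexQCenter E w q u → IsVertexQCenter E w q v →
    (p : Walk E u v) → IsPath p →
    ∀ (a b : Fin k) → EdgeOf a b p → IsEdgeQCenter E w q a b
lemma3p16 E tree w w≥0 q _ u v u-center v-center p p-path a b ab∈p S C =
  [ bound u-center , bound v-center ] (component-misses-end tree p p-path ab∈p C)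
  where
  bound : ∀ {z} → IsVertexQCenter E w q z → z ∉ S → weightOf w S ≤ ½ * totalWeight w + q
  bound center = vertexQCenter-bound tree w≥0 center proj₁ C
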